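{- Let $q=p^n$ where $p$ is a prime with $p\equiv 3\pmod 4$ and $n$ is odd, $V=\mathbb{F}_q^3$, $V_+=\{v_+\mid v\in V\}\leq\mathrm{Sym}(V)$ the group of translations $v_+:x\mapsto x+v$, and $E=\{E(x)\mid x\in\mathbb{F}_q\}$ with $E(x)=\begin{pmatrix}1&x&x^2/2\\0&1&x\\0&0&1\end{pmatrix}$ acting on $V$ by left multiplication. Then every elementary abelian subgroup of the group $EV_+\leq\mathrm{Sym}(V)$ of order at least $q^2p$ is contained in $V_+$. In particular, $\mathbf{E}(EV_+)=V_+$.
   Context: For a finite $p$-group $P$, $\mathbf{E}(P)$ denotes the subgroup generated by all elementary abelian subgroups of $P$ of maximal order. -}

module Defs where

open import Level using (Level; _⊔_)
open import Data.Nat using (ℕ; zero; suc)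
open import Data.Product using (Σ; ∃; _×_; _,_)
open import Data.List using (List; []; _∷_; foldr; length)
open import Data.List.Membership.Propositional using (_∈_)
open import Data.List.Relation.Unary.AllPairs using (AllPairs)
open import Relation.Nullary using (¬_)
open import Algebra.Bundles using (CommutativeRing)
import Data.List
import Data.List.Relation.Unary.All

record IsField {c ℓ : Level} (R : CommutativeRing c ℓ) : Set (c ⊔ ℓ) where
  open CommutativeRing R
  field
    1≉0     : ¬ (1# ≈ 0#)
    _⁻¹     : Carrier → Carrier
    inverse : ∀ x → ¬ (x ≈ 0#) → (x * (x ⁻¹)) ≈ 1#

iterate : {a : Level} {A : Set a} → (A → A) → ℕ → A → A
iterate f zero    x = x
iterate f (suc k) x = f (iterate f k x)

composeAll : {a : Level} {A : Set a} → List (A → A) → A → A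
composeAll = foldr (λ f g x → f (g x)) (λ x → x)

module EV {c ℓ : Level} (R : CommutativeRing c ℓ) (Fld : IsField R) (p : ℕ) where
  open CommutativeRing R
  open IsField Fld

  V : Set c
  V = Carrier × Carrier × Carrier

  _≈V_ : V → V → Set ℓ
  (a , b , d) ≈V (a' , b' , d') = (a ≈ a') × (b ≈ b') × (d ≈ d')

  _+V_ : V → V → V
  (a , b , d) +V (a' , b' , d') = (a + a') , (b + b') , (d + d')

  half : Carrier
  half = (1# + 1#) ⁻¹

  -- left multiplication by E(x) = [[1, x, x^2/2], [0, 1, x], [0, 0, 1]]
  Emul : Carrier → V → V
  Emul x (a , b , d) = (a + x * b + ((x * x) * half) * d) , (b + x * d) , d

  -- pointwise (extensional) equality of maps V → V, i.e. equality in Sym(V)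
  _≐_ : (V → V) → (V → V) → Set (c ⊔ ℓ)
  f ≐ g = ∀ u → f u ≈V g u

  idV : V → V
  idV u = u

  _∘V_ : (V → V) → (V → V) → V → V
  (f ∘V g) u = f (g u)

  translation : V → V → V
  translation v u = u +V v

  -- elements of E V_+ : the pair (x , v) names the permutation u ↦ E(x) u + v
  Elt : Set c
  Elt = Carrier × V

  act : Elt → V → V
  act (x , v) u = Emul x u +V v

  IsTranslation : (V → V) → Set (c ⊔ ℓ)
  IsTranslation f = ∃ λ v → f ≐ translation v

  -- H (a finite list of elements of E V_+, pairwise distinct as permutations)
  -- is an elementary abelian p-subgroup of E V_+ ≤ Sym(V); its order is length H.
  record ElemAbelian (H : List Elt) : Set (c ⊔ ℓ) where
    field
      distinct : AllPairs (λ g h → ¬ (act g ≐ act h)) H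
      hasId    : ∃ λ e → (e ∈ H) × (act e ≐ idV)
      closed   : ∀ {g h} → g ∈ H → h ∈ H → ∃ λ k → (k ∈ H) × (act k ≐ (act g ∘V act h))
      inverses : ∀ {g} → g ∈ H → ∃ λ k → (k ∈ H) × ((act k ∘V act g) ≐ idV)
      abelian  : ∀ {g h} → g ∈ H → h ∈ H → (act g ∘V act h) ≐ (act h ∘V act g)
      exponent : ∀ {g} → g ∈ H → iterate (act g) p ≐ idV

  MaxElemAbelian : List Elt → Set (c ⊔ ℓ)
  MaxElemAbelian H = ElemAbelian H × (∀ K → ElemAbelian K → length K Data.Nat.≤ length H)

  -- f ∈ E(E V_+): f is a product of elements lying in elementary abelian
  -- subgroups of maximal order (the subgroup generated by them, the group being finite)
  InEE : (V → V) → Set (c ⊔ ℓ)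
  InEE f = ∃ λ (gs : List Elt) →
             Data.List.Relation.Unary.All.All (λ g → ∃ λ H → MaxElemAbelian H × (g ∈ H)) gs
           × (f ≐ composeAll (Data.List.map act gs))

-- For g = (x , v) with x ≠ 0, commuting with h = (y , w) means
-- (E(x) − I) w = (E(y) − I) v, which determines w from y and its first
-- coordinate; so the centraliser of g has at most q² elements, and an abelian
-- subgroup of order > q² consists of translations.  Conversely V₊ is
-- elementary abelian of order q³ (a field with pⁿ elements has characteristic
-- p), so every elementary abelian subgroup of maximal order lies in V₊.
module Submission where

open import Level using (Level; _⊔_)
open import Data.Nat as ℕ using (ℕ; zero; suc; _≤_; _<_; _^_; s≤s; NonZero)
import Data.Nat.Properties as ℕP
open import Data.Nat.DivMod using (m%n≤m)
open import Data.Fin as F using (Fin; zero; suc)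
import Data.Fin.Properties as FP
import Data.Fin.Permutation as Perm
open import Data.Product using (∃; _×_; _,_; proj₁; proj₂)
open import Data.Product.Relation.Binary.Pointwise.NonDependent using (_×ₛ_; Pointwise-≡↔≡)
open import Data.Product.Function.NonDependent.Setoid using (_×-bijection_)
open import Data.List using (List; []; _∷_; length; lookup; tabulate)
import Data.List.Properties as ListP
open import Data.List.Relation.Unary.All as All using (All; []; _∷_; all?)
open import Data.List.Relation.Unary.All.Properties using (¬All⇒Any¬; map⁺)
open import Data.List.Relation.Unary.AllPairs using (AllPairs; _∷_)
import Data.List.Relation.Unary.AllPairs.Properties as AllPairsP
open import Data.List.Membership.Propositional using (_∈_; find)
open import Data.List.Membership.Propositional.Properties
  using (∈-lookup; ∈-tabulate⁺; ∈-tabulate⁻)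
open import Function.Base using (_∘_)
open import Function.Bundles using (Bijection; _⇔_; mk⇔)
open import Function.Properties.Inverse using (Inverse⇒Bijection)
import Function.Properties.Inverse as Inverse
import Function.Properties.Bijection as BijectionP
open import Relation.Nullary using (¬_; yes; no)
import Relation.Nullary.Decidable as Dec
open import Relation.Nullary.Negation using (contradiction)
open import Relation.Unary using () renaming (Decidable to Decidable₁)
open import Relation.Binary.Bundles using (Setoid)
open import Relation.Binary.Definitions using (Decidable)
open import Relation.Binary.PropositionalEquality as ≡ using (_≡_)
open import Algebra.Bundles using (CommutativeRing; AbelianGroup)
import Algebra.Construct.DirectProduct as DirectProduct
import Algebra.Properties.Group as GroupProperties
import Algebra.Properties.CommutativeSemigroup as CommutativeSemigroupProperties
import Algebra.Properties.Monoid.Mult as MonoidMult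
import Algebra.Properties.Semiring.Mult as SemiringMult
import Algebra.Properties.CommutativeMonoid.Sum as Sum
import Relation.Binary.Reasoning.Setoid as SetoidReasoning
open import Defs

module _ {a r} {A : Set a} {R : A → A → Set r} where

  AllPairs-lookup : ∀ {xs} → AllPairs R xs →
    ∀ {i j} → i F.< j → R (lookup xs i) (lookup xs j)
  AllPairs-lookup (Rx ∷ _)   {zero}  {suc j} _         = All.lookup Rx (∈-lookup j)
  AllPairs-lookup (_ ∷ Rxs) {suc i} {suc j} (s≤s i<j) = AllPairs-lookup Rxs i<j

  AllPairs⇒length≤ : ∀ {m xs} (code : A → Fin m) →
    (∀ {x y} → x ∈ xs → y ∈ xs → R x y → ¬ code x ≡ code y) →
    AllPairs R xs → length xs ≤ m
  AllPairs⇒length≤ {xs = xs} code separates pairwise = ℕP.≮⇒≥ λ m<length →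
    let i , j , i<j , codeᵢ≡codeⱼ = FP.pigeonhole m<length (code ∘ lookup xs) in
    separates (∈-lookup i) (∈-lookup j) (AllPairs-lookup pairwise i<j) codeᵢ≡codeⱼ

module FiniteSetoid {c ℓ} {S : Setoid c ℓ} {m} (B : Bijection (≡.setoid (Fin m)) S) where
  open Setoid S
  open Bijection B public using (to; to⁻; injective)
  open Bijection B using (strictlySurjective)

  to∘to⁻ : ∀ x → to (to⁻ x) ≈ x
  to∘to⁻ x = proj₂ (strictlySurjective x)

  to⁻∘to : ∀ i → to⁻ (to i) ≡ i
  to⁻∘to i = injective (to∘to⁻ (to i))

  to⁻-cong : ∀ {x y} → x ≈ y → to⁻ x ≡ to⁻ y
  to⁻-cong x≈y = injective (trans (to∘to⁻ _) (trans x≈y (sym (to∘to⁻ _))))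

  to⁻-injective : ∀ {x y} → to⁻ x ≡ to⁻ y → x ≈ y
  to⁻-injective {x} {y} eq =
    trans (sym (to∘to⁻ x)) (trans (reflexive (≡.cong to eq)) (to∘to⁻ y))

  _≟_ : Decidable _≈_
  x ≟ y = Dec.map′ to⁻-injective to⁻-cong (to⁻ x FP.≟ to⁻ y)

Fin-*-bijection : ∀ {c₁ ℓ₁ c₂ ℓ₂} {S : Setoid c₁ ℓ₁} {T : Setoid c₂ ℓ₂} {m n} →
  Bijection (≡.setoid (Fin m)) S → Bijection (≡.setoid (Fin n)) T →
  Bijection (≡.setoid (Fin (m ℕ.* n))) (S ×ₛ T)
Fin-*-bijection B C = BijectionP.trans (Inverse⇒Bijection FP.*↔×)
  (BijectionP.trans (Inverse⇒Bijection (Inverse.sym Pointwise-≡↔≡)) (B ×-bijection C))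

module _ {a ℓ} (G : AbelianGroup a ℓ) where
  open AbelianGroup G
  open GroupProperties group using (identityʳ-unique; //-rightDividesˡ; //-rightDividesʳ)
  open MonoidMult monoid using () renaming (_×_ to _·_)
  open Sum commutativeMonoid
    using (sum; sum-permute; ∑-distrib-+; sum-replicate; sum-cong-≋)
  open SetoidReasoning setoid

  -- Summing all elements, and the same elements shifted by g, gives S = S + m·g.
  ·-order≈ε : ∀ {m} → Bijection (≡.setoid (Fin m)) setoid → ∀ g → m · g ≈ ε
  ·-order≈ε {m} B g = identityʳ-unique (sum to) (m · g) (begin
    sum to ∙ m · g                   ≈⟨ ∙-congˡ (sum-replicate m) ⟨
    sum to ∙ sum {m} (λ _ → g)       ≈⟨ ∑-distrib-+ to (λ _ → g) ⟨
    sum (λ i → to i ∙ g)             ≈⟨ sum-cong-≋ (λ i → sym (to∘to⁻ (to i ∙ g))) ⟩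
    sum (λ i → to (shift g i))       ≈⟨ sum-permute to shiftₚ ⟨
    sum to                           ∎)
    where
    open FiniteSetoid B
    shift : Carrier → Fin m → Fin m
    shift h i = to⁻ (to i ∙ h)
    shift-shift : ∀ h h′ i → to i ∙ h ∙ h′ ≈ to i → shift h′ (shift h i) ≡ i
    shift-shift h h′ i eq = ≡.trans (to⁻-cong (trans (∙-congʳ (to∘to⁻ _)) eq)) (to⁻∘to i)
    shiftₚ : Perm.Permutation m m
    shiftₚ = Perm.permutation (shift g) (shift (g ⁻¹))
      (λ i → shift-shift (g ⁻¹) g i (//-rightDividesˡ g (to i)))
      (λ i → shift-shift g (g ⁻¹) i (//-rightDividesʳ g (to i)))

module _ {c ℓ} (R : CommutativeRing c ℓ) (Fld : IsField R) where
  open CommutativeRing R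
  open IsField Fld
  open SemiringMult semiring
    using (×-homo-1; ×1-homo-*; ×-assoc-*; ×-congʳ) renaming (_×_ to _·_)
  open SetoidReasoning setoid

  *-cancelˡ-≉0 : ∀ {x y z} → ¬ x ≈ 0# → x * y ≈ x * z → y ≈ z
  *-cancelˡ-≉0 {x} {y} {z} x≉0 xy≈xz = begin
    y                  ≈⟨ x⁻¹x· y ⟨
    x ⁻¹ * (x * y)     ≈⟨ *-congˡ xy≈xz ⟩
    x ⁻¹ * (x * z)     ≈⟨ x⁻¹x· z ⟩
    z                  ∎
    where
    x⁻¹x· : ∀ w → x ⁻¹ * (x * w) ≈ w
    x⁻¹x· w = begin
      x ⁻¹ * (x * w)   ≈⟨ *-assoc _ _ _ ⟨
      x ⁻¹ * x * w     ≈⟨ *-congʳ (*-comm _ _) ⟩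
      x * x ⁻¹ * w     ≈⟨ *-congʳ (inverse x x≉0) ⟩
      1# * w           ≈⟨ *-identityˡ w ⟩
      w                ∎

  ^·1≈0⇒·1≈0 : Decidable _≈_ → ∀ m k → (m ^ k) · 1# ≈ 0# → m · 1# ≈ 0#
  ^·1≈0⇒·1≈0 _ m zero 1·1≈0 = contradiction (trans (sym (×-homo-1 1#)) 1·1≈0) 1≉0
  ^·1≈0⇒·1≈0 _≟_ m (suc k) mᵏ⁺¹·1≈0 with (m · 1#) ≟ 0#
  ... | yes m·1≈0 = m·1≈0
  ... | no m·1≉0 = ^·1≈0⇒·1≈0 _≟_ m k (*-cancelˡ-≉0 m·1≉0 (begin
    m · 1# * (m ^ k) · 1#  ≈⟨ ×1-homo-* m (m ^ k) ⟨
    (m ^ suc k) · 1#       ≈⟨ mᵏ⁺¹·1≈0 ⟩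
    0#                     ≈⟨ zeroʳ _ ⟨
    m · 1# * 0#            ∎))

  ·1≈0⇒·≈0 : ∀ {m} → m · 1# ≈ 0# → ∀ a → m · a ≈ 0#
  ·1≈0⇒·≈0 {m} m·1≈0 a = begin
    m · a          ≈⟨ ×-congʳ m (*-identityˡ a) ⟨
    m · (1# * a)   ≈⟨ ×-assoc-* m 1# a ⟨
    m · 1# * a     ≈⟨ *-congʳ m·1≈0 ⟩
    0# * a         ≈⟨ zeroˡ a ⟩
    0#             ∎

module EVGroup {c ℓ} (R : CommutativeRing c ℓ) (Fld : IsField R) (p : ℕ) where
  open CommutativeRing R
  open IsField Fld
  open EV R Fld p
  open SemiringMult semiring using () renaming (_×_ to _·_)
  open GroupProperties +-group using (∙-cancelʳ)

  V-abelianGroup : AbelianGroup c ℓ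
  V-abelianGroup = DirectProduct.abelianGroup +-abelianGroup
    (DirectProduct.abelianGroup +-abelianGroup +-abelianGroup)

  module V where
    open AbelianGroup V-abelianGroup public
    open GroupProperties group public using (∙-cancelˡ)
    open CommutativeSemigroupProperties commutativeSemigroup public
      using (xy∙z≈xz∙y; xy∙z≈zx∙y; xy∙z≈x∙zy)

  module ≈V-Reasoning = SetoidReasoning V.setoid

  -- Δ x u = (E(x) − I) u
  Δ : Carrier → V → V
  Δ x (a , b , d) = x * b + ((x * x) * half) * d , x * d , 0#

  Emul≈+Δ : ∀ x u → Emul x u ≈V (u +V Δ x u)
  Emul≈+Δ x (a , b , d) = +-assoc _ _ _ , refl , sym (+-identityʳ d)

  Δ-cong : ∀ {x x′ u u′} → x ≈ x′ → u ≈V u′ → Δ x u ≈V Δ x′ u′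
  Δ-cong x≈x′ (_ , b≈b′ , d≈d′) =
    +-cong (*-cong x≈x′ b≈b′) (*-cong (*-congʳ (*-cong x≈x′ x≈x′)) d≈d′) , *-cong x≈x′ d≈d′ , refl

  Δ-0 : ∀ {x} → x ≈ 0# → ∀ u → Δ x u ≈V V.ε
  Δ-0 {x} x≈0 (a , b , d) = first , x*≈0 d , refl
    where
    x*≈0 : ∀ y → x * y ≈ 0#
    x*≈0 y = trans (*-congʳ x≈0) (zeroˡ y)
    first : x * b + ((x * x) * half) * d ≈ 0#
    first = begin
      x * b + ((x * x) * half) * d   ≈⟨ +-congˡ (*-congʳ (*-assoc x x half)) ⟩
      x * b + (x * (x * half)) * d   ≈⟨ +-congˡ (*-assoc _ _ _) ⟩
      x * b + x * ((x * half) * d)   ≈⟨ +-cong (x*≈0 b) (x*≈0 _) ⟩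
      0# + 0#                        ≈⟨ +-identityʳ 0# ⟩
      0#                             ∎
      where open SetoidReasoning setoid

  Δ-injective : ∀ {x u u′} → ¬ x ≈ 0# → proj₁ u ≈ proj₁ u′ → Δ x u ≈V Δ x u′ → u ≈V u′
  Δ-injective x≉0 a≈a′ (xb+⋯≈xb′+⋯ , xd≈xd′ , _) =
    a≈a′ , *-cancelˡ-≉0 R Fld x≉0 xb≈xb′ , d≈d′
    where
    d≈d′ = *-cancelˡ-≉0 R Fld x≉0 xd≈xd′
    xb≈xb′ = ∙-cancelʳ _ _ _ (trans xb+⋯≈xb′+⋯ (+-congˡ (*-congˡ (sym d≈d′))))

  Emul-cong : ∀ {x x′ u u′} → x ≈ x′ → u ≈V u′ → Emul x u ≈V Emul x′ u′
  Emul-cong {x} {x′} {u} {u′} x≈x′ u≈u′ = begin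
    Emul x u          ≈⟨ Emul≈+Δ x u ⟩
    u +V Δ x u        ≈⟨ V.∙-cong u≈u′ (Δ-cong x≈x′ u≈u′) ⟩
    u′ +V Δ x′ u′     ≈⟨ Emul≈+Δ x′ u′ ⟨
    Emul x′ u′        ∎
    where open ≈V-Reasoning

  act-cong : ∀ {x x′ v v′ u u′} → x ≈ x′ → v ≈V v′ → u ≈V u′ → act (x , v) u ≈V act (x′ , v′) u′
  act-cong x≈x′ v≈v′ u≈u′ = V.∙-cong (Emul-cong x≈x′ u≈u′) v≈v′

  act-translation : ∀ {x v} → x ≈ 0# → act (x , v) ≐ translation v
  act-translation {x} {v} x≈0 u = begin
    Emul x u +V v          ≈⟨ V.∙-congʳ (Emul≈+Δ x u) ⟩
    (u +V Δ x u) +V v      ≈⟨ V.∙-congʳ (V.∙-congˡ (Δ-0 x≈0 u)) ⟩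
    (u +V V.ε) +V v        ≈⟨ V.∙-congʳ (V.identityʳ u) ⟩
    u +V v                 ∎
    where open ≈V-Reasoning

  InV₊ : Elt → Set ℓ
  InV₊ (x , _) = x ≈ 0#

  InV₊⇒IsTranslation : ∀ {g} → InV₊ g → IsTranslation (act g)
  InV₊⇒IsTranslation {_ , v} x≈0 = v , act-translation x≈0

  Commute : Elt → Elt → Set (c ⊔ ℓ)
  Commute g h = (act g ∘V act h) ≐ (act h ∘V act g)

  Distinct : Elt → Elt → Set (c ⊔ ℓ)
  Distinct g h = ¬ (act g ≐ act h)

  act-act-origin : ∀ x v y w → act (x , v) (act (y , w) V.ε) ≈V ((w +V Δ x w) +V v)
  act-act-origin x v y w = begin
    act (x , v) (Emul y V.ε +V w)   ≈⟨ act-cong refl V.refl (V.∙-congʳ Emul-origin) ⟩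
    act (x , v) (V.ε +V w)          ≈⟨ act-cong refl V.refl (V.identityˡ w) ⟩
    Emul x w +V v                   ≈⟨ V.∙-congʳ (Emul≈+Δ x w) ⟩
    (w +V Δ x w) +V v               ∎
    where
    open ≈V-Reasoning
    Emul-origin : Emul y V.ε ≈V V.ε
    Emul-origin = V.trans (Emul≈+Δ y V.ε)
      (V.trans (V.identityˡ _)
        (trans (+-cong (zeroʳ y) (zeroʳ _)) (+-identityʳ 0#) , zeroʳ y , refl))

  commute⇒Δ≈Δ : ∀ {x v y w} → Commute (x , v) (y , w) → Δ x w ≈V Δ y v
  commute⇒Δ≈Δ {x} {v} {y} {w} g∘h≐h∘g = V.∙-cancelˡ (w +V v) _ _ (begin
    (w +V v) +V Δ x w                ≈⟨ V.xy∙z≈xz∙y w v (Δ x w) ⟩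
    (w +V Δ x w) +V v                ≈⟨ act-act-origin x v y w ⟨
    act (x , v) (act (y , w) V.ε)    ≈⟨ g∘h≐h∘g V.ε ⟩
    act (y , w) (act (x , v) V.ε)    ≈⟨ act-act-origin y w x v ⟩
    (v +V Δ y v) +V w                ≈⟨ V.xy∙z≈zx∙y v (Δ y v) w ⟩
    (w +V v) +V Δ y v                ∎)
    where open ≈V-Reasoning

  commute-determined : ∀ {x v y w y′ w′} → ¬ x ≈ 0# →
    Commute (x , v) (y , w) → Commute (x , v) (y′ , w′) →
    y ≈ y′ → proj₁ w ≈ proj₁ w′ → act (y , w) ≐ act (y′ , w′)
  commute-determined {x} {v} {y} {w} {y′} {w′} x≉0 commute commute′ y≈y′ w₁≈w₁′ _ =
    act-cong y≈y′ (Δ-injective x≉0 w₁≈w₁′ Δw≈Δw′) V.refl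
    where
    Δw≈Δw′ : Δ x w ≈V Δ x w′
    Δw≈Δw′ = V.trans (commute⇒Δ≈Δ commute)
               (V.trans (Δ-cong {u = v} y≈y′ V.refl) (V.sym (commute⇒Δ≈Δ commute′)))

  ∘-translation : ∀ {f g v w} → f ≐ translation v → g ≐ translation w →
    (f ∘V g) ≐ translation (w +V v)
  ∘-translation {g = g} {v} {w} f≐ g≐ u =
    V.trans (f≐ (g u)) (V.trans (V.∙-congʳ (g≐ u)) (V.assoc u w v))

  composeAll-translation : ∀ {fs} → All IsTranslation fs → IsTranslation (composeAll fs)
  composeAll-translation [] = V.ε , λ u → V.sym (V.identityʳ u)
  composeAll-translation ((v , f≐) ∷ fs-translations) =
    let w , fs≐ = composeAll-translation fs-translations in w +V v , ∘-translation f≐ fs≐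

  translation-injective : ∀ {v w} → translation v ≐ translation w → v ≈V w
  translation-injective {v} {w} v≐w =
    V.trans (V.sym (V.identityˡ v)) (V.trans (v≐w V.ε) (V.identityˡ w))

  iterate-translation : ∀ {f a b d} → f ≐ translation (a , b , d) →
    ∀ k → iterate f k ≐ translation (k · a , k · b , k · d)
  iterate-translation f≐ zero    u = V.sym (V.identityʳ u)
  iterate-translation {f} {a} {b} {d} f≐ (suc k) u = V.trans (f≐ (iterate f k u))
    (V.trans (V.∙-congʳ (iterate-translation f≐ k u)) (V.xy∙z≈x∙zy u _ (a , b , d)))

  iterate-translation-p : p · 1# ≈ 0# → ∀ {f w} → f ≐ translation w → iterate f p ≐ idV
  iterate-translation-p p·1≈0 {w = a , b , d} f≐ u = V.trans (iterate-translation f≐ p u)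
    (V.trans (V.∙-congˡ (p·≈0 a , p·≈0 b , p·≈0 d)) (V.identityʳ u))
    where
    p·≈0 : ∀ a → p · a ≈ 0#
    p·≈0 = ·1≈0⇒·≈0 R Fld {p} p·1≈0

  module Finite {q} (B : Bijection (≡.setoid (Fin q)) setoid) where
    open FiniteSetoid B using (_≟_; to⁻)
    open FiniteSetoid (Fin-*-bijection B B) using ()
      renaming (to⁻ to index²; to⁻-injective to index²-injective)
    open FiniteSetoid (Fin-*-bijection B (Fin-*-bijection B B)) using ()
      renaming (to to vector; injective to vector-injective; to⁻ to index³;
                to⁻-injective to index³-injective; to∘to⁻ to vector∘index³)

    instance
      q≢0 : NonZero q
      q≢0 = FP.nonZeroIndex (to⁻ 0#)

    InV₊? : Decidable₁ InV₊
    InV₊? (x , _) = x ≟ 0#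

    order-pⁿ⇒p·1≈0 : ∀ n → q ≡ p ^ n → p · 1# ≈ 0#
    order-pⁿ⇒p·1≈0 n ≡.refl = ^·1≈0⇒·1≈0 R Fld _≟_ p n (·-order≈ε +-abelianGroup B 1#)

    centraliser-length≤ : ∀ {g H} → ¬ InV₊ g → AllPairs Distinct H → All (Commute g) H →
      length H ≤ q ℕ.* q
    centraliser-length≤ {g} {H} x≉0 distinct commuting = AllPairs⇒length≤ code separated distinct
      where
      code : Elt → Fin (q ℕ.* q)
      code (y , w₁ , _) = index² (y , w₁)
      separated : ∀ {h h′} → h ∈ H → h′ ∈ H → Distinct h h′ → ¬ code h ≡ code h′
      separated h∈ h′∈ h≠h′ eq = let y≈y′ , w₁≈w₁′ = index²-injective eq in
        h≠h′ (commute-determined x≉0 (All.lookup commuting h∈) (All.lookup commuting h′∈)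
                                 y≈y′ w₁≈w₁′)

    translations-length≤ : ∀ {H} → AllPairs Distinct H → All InV₊ H →
      length H ≤ q ℕ.* (q ℕ.* q)
    translations-length≤ {H} distinct ⊆V₊ =
      AllPairs⇒length≤ (index³ ∘ proj₂) separated distinct
      where
      separated : ∀ {h h′} → h ∈ H → h′ ∈ H → Distinct h h′ →
        ¬ index³ (proj₂ h) ≡ index³ (proj₂ h′)
      separated h∈ h′∈ h≠h′ eq = h≠h′ λ _ →
        act-cong (trans (All.lookup ⊆V₊ h∈) (sym (All.lookup ⊆V₊ h′∈))) (index³-injective eq) V.refl

    ¬All⇒nonTranslation : ∀ {H} → ¬ All InV₊ H → ∃ λ g → g ∈ H × ¬ InV₊ g
    ¬All⇒nonTranslation {H} = find ∘ ¬All⇒Any¬ InV₊? H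

    ElemAbelian-nonTranslation⇒length≤ : ∀ {H g} → ElemAbelian H → g ∈ H → ¬ InV₊ g →
      length H ≤ q ℕ.* q
    ElemAbelian-nonTranslation⇒length≤ EA g∈ x≉0 =
      centraliser-length≤ x≉0 (ElemAbelian.distinct EA) (All.tabulate (ElemAbelian.abelian EA g∈))

    ElemAbelian-long⇒⊆V₊ : ∀ {H} → ElemAbelian H → q ℕ.* q < length H → All InV₊ H
    ElemAbelian-long⇒⊆V₊ {H} EA long with all? InV₊? H
    ... | yes H⊆V₊ = H⊆V₊
    ... | no H⊈V₊ = let _ , g∈ , x≉0 = ¬All⇒nonTranslation H⊈V₊ in
      contradiction (ElemAbelian-nonTranslation⇒length≤ EA g∈ x≉0) (ℕP.<⇒≱ long)

    ElemAbelian-length≤ : ∀ {H} → ElemAbelian H → length H ≤ q ℕ.* (q ℕ.* q)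
    ElemAbelian-length≤ {H} EA with all? InV₊? H
    ... | yes H⊆V₊ = translations-length≤ (ElemAbelian.distinct EA) H⊆V₊
    ... | no H⊈V₊ = let _ , g∈ , x≉0 = ¬All⇒nonTranslation H⊈V₊ in
      ℕP.≤-trans (ElemAbelian-nonTranslation⇒length≤ EA g∈ x≉0) (ℕP.m≤n*m (q ℕ.* q) q)

    V₊ : List Elt
    V₊ = tabulate λ i → 0# , vector i

    V₊-length : length V₊ ≡ q ℕ.* (q ℕ.* q)
    V₊-length = ListP.length-tabulate _

    translationElt : V → Elt
    translationElt v = 0# , vector (index³ v)

    translationElt∈V₊ : ∀ v → translationElt v ∈ V₊
    translationElt∈V₊ v = ∈-tabulate⁺ (index³ v)

    act-translationElt : ∀ v → act (translationElt v) ≐ translation v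
    act-translationElt v u = V.trans (act-translation refl u) (V.∙-congˡ (vector∘index³ v))

    ∈V₊⇒translation : ∀ {g} → g ∈ V₊ → act g ≐ translation (proj₂ g)
    ∈V₊⇒translation g∈ with ∈-tabulate⁻ g∈
    ... | _ , ≡.refl = act-translation refl

    V₊-ElemAbelian : p · 1# ≈ 0# → ElemAbelian V₊
    V₊-ElemAbelian p·1≈0 = record
      { distinct = AllPairsP.tabulate⁺ λ i≢j act≐act →
          i≢j (vector-injective (translation-injective λ u →
            V.trans (V.sym (act-translation refl u)) (V.trans (act≐act u) (act-translation refl u))))
      ; hasId    = translationElt V.ε , translationElt∈V₊ V.ε ,
          λ u → V.trans (act-translationElt V.ε u) (V.identityʳ u)
      ; closed   = λ {g} {h} g∈ h∈ → translationElt (proj₂ h +V proj₂ g) , translationElt∈V₊ _ ,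
          λ u → V.trans (act-translationElt _ u) (V.sym (∘V₊ g∈ h∈ u))
      ; inverses = λ {g} g∈ → translationElt (proj₂ g V.⁻¹) , translationElt∈V₊ _ ,
          λ u → V.trans (∘-translation (act-translationElt _) (∈V₊⇒translation g∈) u)
                  (V.trans (V.∙-congˡ (V.inverseʳ _)) (V.identityʳ u))
      ; abelian  = λ g∈ h∈ u →
          V.trans (∘V₊ g∈ h∈ u) (V.trans (V.∙-congˡ (V.comm _ _)) (V.sym (∘V₊ h∈ g∈ u)))
      ; exponent = λ g∈ → iterate-translation-p p·1≈0 (∈V₊⇒translation g∈)
      }
      where
      ∘V₊ : ∀ {g h} → g ∈ V₊ → h ∈ V₊ → (act g ∘V act h) ≐ translation (proj₂ h +V proj₂ g)
      ∘V₊ g∈ h∈ = ∘-translation (∈V₊⇒translation g∈) (∈V₊⇒translation h∈)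

    V₊-maximal : p · 1# ≈ 0# → MaxElemAbelian V₊
    V₊-maximal p·1≈0 = V₊-ElemAbelian p·1≈0 ,
      λ K EK → ≡.subst (length K ≤_) (≡.sym V₊-length) (ElemAbelian-length≤ EK)

    MaxElemAbelian⇒⊆V₊ : 1 < q → p · 1# ≈ 0# → ∀ {H} → MaxElemAbelian H → All InV₊ H
    MaxElemAbelian⇒⊆V₊ 1<q p·1≈0 {H} (EH , maximal) = ElemAbelian-long⇒⊆V₊ EH (begin-strict
      q ℕ.* q                  <⟨ ℕP.m<m*n (q ℕ.* q) q {{ℕP.m*n≢0 q q}} 1<q ⟩
      q ℕ.* q ℕ.* q            ≡⟨ ℕP.*-assoc q q q ⟩
      q ℕ.* (q ℕ.* q)          ≡⟨ V₊-length ⟨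
      length V₊                ≤⟨ maximal V₊ (V₊-ElemAbelian p·1≈0) ⟩
      length H                 ∎)
      where
      open ℕP.≤-Reasoning

    InEE⇔IsTranslation : 1 < q → p · 1# ≈ 0# → ∀ f → InEE f ⇔ IsTranslation f
    InEE⇔IsTranslation 1<q p·1≈0 f = mk⇔
      (λ (gs , gs-max , f≐) →
        let w , gs≐ = composeAll-translation (map⁺ (All.map ∈Max⇒IsTranslation gs-max))
        in w , λ u → V.trans (f≐ u) (gs≐ u))
      (λ (v , f≐) → translationElt v ∷ [] , (V₊ , V₊-maximal p·1≈0 , translationElt∈V₊ v) ∷ [] ,
         λ u → V.trans (f≐ u) (V.sym (act-translationElt v u)))
      where
      ∈Max⇒IsTranslation : ∀ {g} → (∃ λ H → MaxElemAbelian H × g ∈ H) → IsTranslation (act g)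
      ∈Max⇒IsTranslation (H , H-max , g∈) =
        InV₊⇒IsTranslation (All.lookup (MaxElemAbelian⇒⊆V₊ 1<q p·1≈0 H-max) g∈)

open import Data.Nat using (_*_; _%_)
open import Data.Nat.Primality using (Prime)
open import Relation.Binary.PropositionalEquality using (setoid)

-- The hypotheses on p and n are used only through 3 ≤ p and 1 ≤ n.
proposition6p5 : {c ℓ : Level} (R : CommutativeRing c ℓ) (Fld : IsField R) (p n : ℕ) →
    Prime p → p % 4 ≡ 3 → n % 2 ≡ 1 →
    Bijection (setoid (Fin (p ^ n))) (CommutativeRing.setoid R) →
    (∀ H → EV.ElemAbelian R Fld p H → (p ^ n) * (p ^ n) * p ≤ length H →
    All (λ g → EV.IsTranslation R Fld p (EV.act R Fld p g)) H)
    × (∀ f → EV.InEE R Fld p f ⇔ EV.IsTranslation R Fld p f)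
proposition6p5 R Fld p n _ p%4≡3 n%2≡1 B =
  (λ H EA long → All.map InV₊⇒IsTranslation (ElemAbelian-long⇒⊆V₊ EA (ℕP.<-≤-trans q*q<q*q*p long)))
  , InEE⇔IsTranslation 1<q (order-pⁿ⇒p·1≈0 n ≡.refl)
  where
  open EVGroup R Fld p
  open Finite B
  q : ℕ
  q = p ^ n
  1<p : 1 < p
  1<p = ℕP.≤-trans (ℕP.n≤1+n 2) (≡.subst (_≤ p) p%4≡3 (m%n≤m p 4))
  1<q : 1 < q
  1<q = ℕP.^-monoʳ-< p 1<p (≡.subst (_≤ n) n%2≡1 (m%n≤m n 2))
  q*q<q*q*p : q * q < q * q * p
  q*q<q*q*p = ℕP.m<m*n (q * q) p {{ℕP.m*n≢0 q q}} 1<p
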